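{- Let $n\ge2$, $x_1,\dots,x_n\in\mathbb{C}$, $v=(1,\dots,1)^T$, $u=(x_1,\dots,x_n)^T$ and $H=vv^*+uu^*$. For $k=1,\dots,n-1$ let $v_k\in\mathbb{C}^n$ be the vector whose $i$-th entry is $n\,e_k(x_i)-(n-k)\,e_k$. Then $$\mathscr{C}_1(H)=\frac{\operatorname{per}(H)}{n}\,vv^*+\sum_{k=1}^{n-1}\frac{(k-1)!\,(n-1-k)!}{n}\,v_kv_k^*.$$
   Context: $e_k$ denotes the $k$-th elementary symmetric polynomial evaluated at $x_1,\dots,x_n$, and $e_k(x_i)$ denotes the $k$-th elementary symmetric polynomial evaluated at the $n-1$ numbers $x_1,\dots,x_{i-1},x_{i+1},\dots,x_n$. For an $n\times n$ matrix $A=(a_{ij})$, $\operatorname{per}(A)=\sum_{\sigma\in S_n}\prod_i a_{i\sigma(i)}$, and $\mathscr{C}_1(A)$ is the $n\times n$ matrix with $(i,j)$ entry $a_{ij}\operatorname{per}(A(i|j))$, where $A(i|j)$ is $A$ with row $i$ and column $j$ deleted. -}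

module Defs where

open import Level using (Level)
open import Data.Nat as ℕ using (ℕ; zero; suc; _!)
open import Data.Fin using (Fin; zero; suc; punchIn)
open import Data.Fin.Properties using (_≟_)
open import Data.Bool using (Bool; true; false; _∧_; _∨_; not; if_then_else_)
open import Data.List using (List; []; _∷_; map; concatMap; foldr; filter)
open import Data.List.Base using (allFin)
open import Relation.Nullary.Decidable using (⌊_⌋)
open import Algebra.Bundles using (CommutativeRing)

Vector : ∀ {a} → Set a → ℕ → Set a
Vector A n = Fin n → A

Matrix : ∀ {a} → Set a → ℕ → Set a
Matrix A n = Fin n → Fin n → A

allFuns : (m n : ℕ) → List (Fin m → Fin n)
allFuns zero    n = (λ ()) ∷ []
allFuns (suc m) n = concatMap (λ f → map (λ j → cons j f) (allFin n)) (allFuns m n)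
  where
  cons : Fin n → (Fin m → Fin n) → Fin (suc m) → Fin n
  cons j f zero    = j
  cons j f (suc i) = f i

allB : ∀ {a} {A : Set a} → (A → Bool) → List A → Bool
allB p = foldr (λ x b → p x ∧ b) true

isInjective : ∀ {n} → (Fin n → Fin n) → Bool
isInjective {n} f =
  allB (λ i → allB (λ j → ⌊ i ≟ j ⌋ ∨ not ⌊ f i ≟ f j ⌋) (allFin n)) (allFin n)

-- The symmetric group S_n, as the list of all bijections Fin n → Fin n
-- (the injective self-maps of a finite set).
permutations : (n : ℕ) → List (Fin n → Fin n)
permutations n = filter (λ f → Data.Bool._≟_ (isInjective f) true) (allFuns n n)
  where import Data.Bool

module _ {c ℓ} (R : CommutativeRing c ℓ) where
  open CommutativeRing R

  sumL : List Carrier → Carrier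
  sumL = foldr _+_ 0#

  Σ[_] : ∀ {n} → (Fin n → Carrier) → Carrier
  Σ[_] {n} f = sumL (map f (allFin n))

  Π[_] : ∀ {n} → (Fin n → Carrier) → Carrier
  Π[_] {n} f = foldr _*_ 1# (map f (allFin n))

  _·_ : ℕ → Carrier → Carrier
  zero  · x = 0#
  suc m · x = x + m · x

  per : ∀ {n} → Matrix Carrier n → Carrier
  per {n} A = sumL (map (λ σ → Π[ (λ i → A i (σ i)) ]) (permutations n))

  minor : ∀ {n} → Matrix Carrier (suc n) → Fin (suc n) → Fin (suc n) → Matrix Carrier n
  minor A i j r s = A (punchIn i r) (punchIn j s)

  C₁ : ∀ {n} → Matrix Carrier (suc n) → Matrix Carrier (suc n)
  C₁ A i j = A i j * per (minor A i j)

  esymL : ℕ → List Carrier → Carrier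
  esymL zero    xs       = 1#
  esymL (suc k) []       = 0#
  esymL (suc k) (x ∷ xs) = x * esymL k xs + esymL (suc k) xs

  esym : ∀ {n} → ℕ → Vector Carrier n → Carrier
  esym {n} k x = esymL k (map x (allFin n))

  -- e_k(x_i): e_k of x with the i-th entry removed
  esymDel : ∀ {n} → ℕ → Vector Carrier (suc n) → Fin (suc n) → Carrier
  esymDel k x i = esym k (λ r → x (punchIn i r))

  module WithConj (conj : Carrier → Carrier) where
    outer : ∀ {n} → Vector Carrier n → Matrix Carrier n
    outer w i j = w i * conj (w j)

    ones : ∀ {n} → Vector Carrier n
    ones _ = 1#

    Hmat : ∀ {n} → Vector Carrier n → Matrix Carrier n
    Hmat x i j = outer ones i j + outer x i j

  vk : ∀ {n} → ℕ → Vector Carrier (suc n) → Vector Carrier (suc n)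
  vk {n} k x i = (suc n · esymDel k x i) - ((suc n ℕ.∸ k) · esym k x)

-- Conjugation as an involutive ring automorphism (complex conjugation on ℂ).
record IsConjugation {c ℓ} (R : CommutativeRing c ℓ)
                     (conj : CommutativeRing.Carrier R → CommutativeRing.Carrier R) : Set (c Level.⊔ ℓ) where
  open CommutativeRing R
  field
    conj-cong : ∀ {a b} → a ≈ b → conj a ≈ conj b
    conj-+    : ∀ a b → conj (a + b) ≈ conj a + conj b
    conj-*    : ∀ a b → conj (a * b) ≈ conj a * conj b
    conj-1    : conj 1# ≈ 1#
    conj-invol : ∀ a → conj (conj a) ≈ a

-- Every entry of H is 1 + x_r x̄_s, and so is every entry of a minor H(i|j); expanding
-- along the first row gives per(J + y zᵀ) = Σ_k k!(N−k)! e_k(y) e_k(z) for N × N matrices.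
-- Let N = n − 1, a_k = e_k(x_r : r ≠ i) and b_k = e_k(x̄_s : s ≠ j). Then
-- 𝒞₁(H)_ij = (1 + x_i x̄_j) Σ_k k!(N−k)! a_k b_k, and e_k(x) = x_i a_{k−1} + a_k expresses
-- per H and the i-th entries of the v_k through the same numbers (likewise x̄_j, b_k).
-- What remains is a polynomial identity in the a_k and b_k: the cross terms x_i a_k b_{k+1}
-- and x̄_j a_{k+1} b_k of per H cancel against those of Σ_k v_k v_k^*, and the remaining
-- coefficients agree because k!(n−k)! + k·k!(N−k)! = n·k!(N−k)! = (k+1)!(N−k)! + (N−k)·k!(N−k)!.
module Submission where

open import Defs
open import Algebra.Bundles using (CommutativeRing)
open import Data.Bool using (Bool; true; false; _∧_; not)
open import Data.Empty using (⊥-elim)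
open import Data.Fin using (Fin; zero; suc; toℕ; punchIn; inject₁; fromℕ)
open import Data.Fin.Properties using (_≟_; punchInᵢ≢i; toℕ<n; toℕ-inject₁; toℕ-fromℕ)
open import Data.List as List using (List; []; _∷_; tabulate; allFin)
open import Data.List.Properties using (map-tabulate; map-∘)
open import Data.Nat using (ℕ; zero; suc; _∸_; _!; _≤_; _<_; _≤?_; s≤s)
open import Data.Nat.Properties
  using (m≤n⇒m≤1+n; m+[n∸m]≡n; m≤n⇒m∸n≡0; ≰⇒>; <⇒≤; ≤-pred; ≤-refl; n∸n≡0; m≤n⇒m<n∨m≡n)
open import Data.Sum using (inj₁; inj₂)
import Data.Vec.Functional as Vector
open import Function using (_∘_; id)
open import Relation.Binary.Core using (_Preserves_⟶_)
open import Relation.Binary.PropositionalEquality as ≡ using (_≡_; _≗_)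
import Relation.Binary.Reasoning.Setoid as SetoidReasoning
open import Relation.Nullary using (yes; no)
open import Relation.Nullary.Decidable using (⌊_⌋)

module Factorial where
  open Data.Nat using (_+_; _*_)
  open import Data.Nat.Properties using (+-∸-assoc)
  open import Data.Nat.Tactic.RingSolver using (solve-∀)

  fac : ℕ → ℕ → ℕ
  fac n k = k ! * (n ∸ k) !

  fac-suc : ∀ n k → fac n k * suc k ≡ fac (suc n) (suc k)
  fac-suc n k = lemma (k !) ((n ∸ k) !) k
    where
    lemma : ∀ a b k → a * b * suc k ≡ (suc k * a) * b
    lemma = solve-∀

  fac-∸ : ∀ {n k} → k ≤ n → fac n k * (suc n ∸ k) ≡ fac (suc n) k
  fac-∸ {n} {k} k≤n rewrite +-∸-assoc 1 k≤n = lemma (k !) ((n ∸ k) !) (n ∸ k)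
    where
    lemma : ∀ a b d → a * b * suc d ≡ a * (suc d * b)
    lemma = solve-∀

  fac-zero : ∀ n → fac (suc n) 0 ≡ suc n * fac n 0
  fac-zero n = lemma (n !) n
    where
    lemma : ∀ a n → 1 * (suc n * a) ≡ suc n * (1 * a)
    lemma = solve-∀

-- Recursive forms of the Boolean injectivity test of Defs, chosen so that
-- injective? (j ∷ f) computes to avoids? j f ∧ injective? f.
module InjectivityTest where
  open import Data.Bool using (_∨_; T)
  open import Data.Bool.Properties using (T-∧)
  open import Data.Fin.Properties using (punchIn-injective; suc-injective; 0≢1+n)
  open import Data.Product using (_×_; _,_)
  open import Function using (_⇔_; mk⇔; Injective)
  open import Function.Bundles using (module Equivalence)
  open import Relation.Binary.PropositionalEquality using (_≢_)
  open import Relation.Nullary.Decidable using (toWitnessFalse; fromWitnessFalse)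
  open Equivalence using (to; from)

  avoids? : ∀ {m k} → Fin k → (Fin m → Fin k) → Bool
  avoids? {zero}  j f = true
  avoids? {suc m} j f = not ⌊ f zero ≟ j ⌋ ∧ avoids? j (f ∘ suc)

  injective? : ∀ {m k} → (Fin m → Fin k) → Bool
  injective? {zero}  f = true
  injective? {suc m} f = avoids? (f zero) (f ∘ suc) ∧ injective? (f ∘ suc)

  avoids?-cong : ∀ {m k} (j : Fin k) {f g : Fin m → Fin k} → f ≗ g → avoids? j f ≡ avoids? j g
  avoids?-cong {zero}  j f≗g = ≡.refl
  avoids?-cong {suc m} j f≗g =
    ≡.cong₂ (λ a b → not ⌊ a ≟ j ⌋ ∧ b) (f≗g zero) (avoids?-cong j (f≗g ∘ suc))

  injective?-cong : ∀ {m k} {f g : Fin m → Fin k} → f ≗ g → injective? f ≡ injective? g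
  injective?-cong {zero}  f≗g = ≡.refl
  injective?-cong {suc m} {f = f} {g} f≗g =
    ≡.cong₂ _∧_ (≡.trans (≡.cong (λ a → avoids? a (f ∘ suc)) (f≗g zero)) (avoids?-cong (g zero) (f≗g ∘ suc)))
                (injective?-cong (f≗g ∘ suc))

  ⌊punchIn≟punchIn⌋ : ∀ {k} (j : Fin (suc k)) (a b : Fin k) → ⌊ punchIn j a ≟ punchIn j b ⌋ ≡ ⌊ a ≟ b ⌋
  ⌊punchIn≟punchIn⌋ j a b with punchIn j a ≟ punchIn j b | a ≟ b
  ... | yes _     | yes _   = ≡.refl
  ... | no  _     | no  _   = ≡.refl
  ... | yes pa≡pb | no a≢b  = ⊥-elim (a≢b (punchIn-injective j a b pa≡pb))
  ... | no pa≢pb  | yes a≡b = ⊥-elim (pa≢pb (≡.cong (punchIn j) a≡b))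

  avoids?-punchIn : ∀ {m k} (j : Fin (suc k)) (j′ : Fin k) (f : Fin m → Fin k) →
                    avoids? (punchIn j j′) (punchIn j ∘ f) ≡ avoids? j′ f
  avoids?-punchIn {zero}  j j′ f = ≡.refl
  avoids?-punchIn {suc m} j j′ f =
    ≡.cong₂ (λ a b → not a ∧ b) (⌊punchIn≟punchIn⌋ j (f zero) j′) (avoids?-punchIn j j′ (f ∘ suc))

  T-⇔⇒≡ : ∀ {x y} → T x ⇔ T y → x ≡ y
  T-⇔⇒≡ {true}  {true}  _   = ≡.refl
  T-⇔⇒≡ {true}  {false} x⇔y = ⊥-elim (to x⇔y _)
  T-⇔⇒≡ {false} {true}  x⇔y = ⊥-elim (from x⇔y _)
  T-⇔⇒≡ {false} {false} _   = ≡.refl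

  T-avoids? : ∀ {m k} (j : Fin k) (f : Fin m → Fin k) → T (avoids? j f) ⇔ (∀ i → f i ≢ j)
  T-avoids? {zero}  j f = mk⇔ (λ _ ()) (λ _ → _)
  T-avoids? {suc m} j f = mk⇔
    (λ t → let t₀ , t′ = to T-∧ t in
           λ { zero → toWitnessFalse t₀ ; (suc i) → to (T-avoids? j (f ∘ suc)) t′ i })
    (λ h → from T-∧ (fromWitnessFalse (h zero) , from (T-avoids? j (f ∘ suc)) (h ∘ suc)))

  T-injective? : ∀ {m k} (f : Fin m → Fin k) → T (injective? f) ⇔ Injective _≡_ _≡_ f
  T-injective? {zero}  f = mk⇔ (λ _ → λ { {()} }) (λ _ → _)
  T-injective? {suc m} f = mk⇔ (inj ∘ to T-∧) λ inj-f → from T-∧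
    ( from (T-avoids? (f zero) (f ∘ suc)) (λ i eq → 0≢1+n (≡.sym (inj-f eq)))
    , from (T-injective? (f ∘ suc)) (suc-injective ∘ inj-f) )
    where
    inj : T (avoids? (f zero) (f ∘ suc)) × T (injective? (f ∘ suc)) → Injective _≡_ _≡_ f
    inj _         {zero}  {zero}   _  = ≡.refl
    inj (t₀ , _)  {zero}  {suc i′} eq = ⊥-elim (to (T-avoids? (f zero) (f ∘ suc)) t₀ i′ (≡.sym eq))
    inj (t₀ , _)  {suc i} {zero}   eq = ⊥-elim (to (T-avoids? (f zero) (f ∘ suc)) t₀ i eq)
    inj (_  , t′) {suc i} {suc i′} eq = ≡.cong suc (to (T-injective? (f ∘ suc)) t′ eq)

  T-allB : ∀ {A : Set} {n} (p : A → Bool) (g : Fin n → A) → T (allB p (tabulate g)) ⇔ (∀ i → T (p (g i)))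
  T-allB {n = zero}  p g = mk⇔ (λ _ ()) (λ _ → _)
  T-allB {n = suc n} p g = mk⇔
    (λ t → let t₀ , t′ = to T-∧ t in
           λ { zero → t₀ ; (suc i) → to (T-allB p (g ∘ suc)) t′ i })
    (λ h → from T-∧ (h zero , from (T-allB p (g ∘ suc)) (h ∘ suc)))

  T-≡∨≢ : ∀ {n} (f : Fin n → Fin n) i i′ →
          T (⌊ i ≟ i′ ⌋ ∨ not ⌊ f i ≟ f i′ ⌋) ⇔ (f i ≡ f i′ → i ≡ i′)
  T-≡∨≢ f i i′ with i ≟ i′ | f i ≟ f i′
  ... | yes i≡i′ | _          = mk⇔ (λ _ _ → i≡i′) (λ _ → _)
  ... | no  _    | no fi≢fi′  = mk⇔ (λ _ eq → ⊥-elim (fi≢fi′ eq)) (λ _ → _)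
  ... | no  i≢i′ | yes fi≡fi′ = mk⇔ (λ ()) (λ h → i≢i′ (h fi≡fi′))

  T-isInjective : ∀ {n} (f : Fin n → Fin n) → T (isInjective f) ⇔ Injective _≡_ _≡_ f
  T-isInjective f = mk⇔
    (λ t {i} {i′} → to (T-≡∨≢ f i i′) (to (T-allB _ id) (to (T-allB _ id) t i) i′))
    (λ h → from (T-allB _ id) λ i → from (T-allB _ id) λ i′ → from (T-≡∨≢ f i i′) h)

  isInjective≡injective? : ∀ {n} (f : Fin n → Fin n) → isInjective f ≡ injective? f
  isInjective≡injective? f = T-⇔⇒≡ (mk⇔
    (from (T-injective? f) ∘ to (T-isInjective f))
    (from (T-isInjective f) ∘ to (T-injective? f)))

open Factorial
open InjectivityTest

module Lemmas {r ℓ} (R : CommutativeRing r ℓ) where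
  open CommutativeRing R hiding (zero)
  open import Algebra.Properties.Ring ring
    using (+-cancelˡ; -‿+-comm; -‿involutive; -0#≈0#; x[y-z]≈xy-xz; [y-z]x≈yx-zx; x+x≈x⇒x≈0; +-inverseˡ-unique)
  open import Algebra.Properties.Semiring.Mult semiring using (_×_; ×-homo-+; ×1-homo-*)
  open import Algebra.Properties.Semiring.Sum semiring
  open import Algebra.Properties.Monoid.Sum *-monoid using () renaming (sum to ∏; sum-cong-≋ to ∏-cong)
  open import Algebra.Solver.Ring.NaturalCoefficients.Default commutativeSemiring
  open SetoidReasoning setoid

  cast : ℕ → Carrier
  cast n = n × 1#

  cast-cong : ∀ {m n} → m ≡ n → cast m ≈ cast n
  cast-cong ≡.refl = refl

  ·≈cast* : ∀ k y → _·_ R k y ≈ cast k * y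
  ·≈cast* zero    y = sym (zeroˡ y)
  ·≈cast* (suc k) y = trans (+-cong (sym (*-identityˡ y)) (·≈cast* k y)) (sym (distribʳ y 1# (cast k)))

  ·-congˡ : ∀ k {y z} → y ≈ z → _·_ R k y ≈ _·_ R k z
  ·-congˡ k {y} {z} y≈z = trans (·≈cast* k y) (trans (*-congˡ y≈z) (sym (·≈cast* k z)))

  cast-fac-suc : ∀ n k → cast (fac n k) * cast (suc k) ≈ cast (fac (suc n) (suc k))
  cast-fac-suc n k = trans (sym (×1-homo-* (fac n k) (suc k))) (cast-cong (fac-suc n k))

  cast-fac-∸ : ∀ {n k} → k ≤ n → cast (fac n k) * cast (suc n ∸ k) ≈ cast (fac (suc n) k)
  cast-fac-∸ {n} {k} k≤n = trans (sym (×1-homo-* (fac n k) (suc n ∸ k))) (cast-cong (fac-∸ k≤n))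

  +-sub-+ : ∀ u v w → (u + w) - (v + w) ≈ u - v
  +-sub-+ u v w = begin
    (u + w) - (v + w)      ≈⟨ +-congˡ (-‿+-comm v w) ⟨
    (u + w) + (- v + - w)  ≈⟨ solve 4 (λ u w v′ w′ → (u :+ w) :+ (v′ :+ w′) := (u :+ v′) :+ (w :+ w′))
                                     refl u w (- v) (- w) ⟩
    (u - v) + (w - w)      ≈⟨ +-congˡ (-‿inverseʳ w) ⟩
    (u - v) + 0#           ≈⟨ +-identityʳ _ ⟩
    u - v                  ∎

  +-+-sub : ∀ x y z → (x + z) + (y - z) ≈ x + y
  +-+-sub x y z = begin
    (x + z) + (y - z)      ≈⟨ solve 4 (λ x y z z′ → (x :+ z) :+ (y :+ z′) := (x :+ y) :+ (z :+ z′))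
                                     refl x y z (- z) ⟩
    (x + y) + (z - z)      ≈⟨ +-congˡ (-‿inverseʳ z) ⟩
    (x + y) + 0#           ≈⟨ +-identityʳ _ ⟩
    x + y                  ∎

  sub-*-sub : ∀ x y x′ y′ → (x - y) * (x′ - y′) ≈ (x * x′ + y * y′) - (x * y′ + y * x′)
  sub-*-sub x y x′ y′ = begin
    (x - y) * (x′ - y′)
      ≈⟨ [y-z]x≈yx-zx (x′ - y′) x y ⟩
    x * (x′ - y′) - y * (x′ - y′)
      ≈⟨ +-cong (x[y-z]≈xy-xz x x′ y′) (-‿cong (x[y-z]≈xy-xz y x′ y′)) ⟩
    (x * x′ - x * y′) - (y * x′ - y * y′)
      ≈⟨ +-congˡ (-‿+-comm (y * x′) (- (y * y′))) ⟨
    (x * x′ - x * y′) + (- (y * x′) + - - (y * y′))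
      ≈⟨ +-congˡ (+-congˡ (-‿involutive (y * y′))) ⟩
    (x * x′ - x * y′) + (- (y * x′) + y * y′)
      ≈⟨ solve 4 (λ a b c d → (a :+ b) :+ (c :+ d) := (a :+ d) :+ (b :+ c))
                 refl (x * x′) (- (x * y′)) (- (y * x′)) (y * y′) ⟩
    (x * x′ + y * y′) + (- (x * y′) + - (y * x′))
      ≈⟨ +-congˡ (-‿+-comm (x * y′) (y * x′)) ⟩
    (x * x′ + y * y′) - (x * y′ + y * x′) ∎

  inverse-cancel : ∀ c c⁻¹ y → c * c⁻¹ ≈ 1# → y ≈ c⁻¹ * (c * y)
  inverse-cancel c c⁻¹ y cc⁻¹≈1 = begin
    y              ≈⟨ *-identityˡ y ⟨
    1# * y         ≈⟨ *-congʳ cc⁻¹≈1 ⟨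
    (c * c⁻¹) * y  ≈⟨ solve 3 (λ c c′ y → (c :* c′) :* y := c′ :* (c :* y)) refl c c⁻¹ y ⟩
    c⁻¹ * (c * y)  ∎

  sumℕ : ℕ → (ℕ → Carrier) → Carrier
  sumℕ K f = ∑[ i < K ] f (toℕ i)

  syntax sumℕ K (λ k → x) = ∑ℕ[ k < K ] x

  sumℕ-cong : ∀ K {f g : ℕ → Carrier} → (∀ k → k < K → f k ≈ g k) → sumℕ K f ≈ sumℕ K g
  sumℕ-cong K f≈g = sum-cong-≋ (λ i → f≈g (toℕ i) (toℕ<n i))

  sumℕ-last : ∀ K (f : ℕ → Carrier) → ∑ℕ[ k < suc K ] f k ≈ ∑ℕ[ k < K ] f k + f K
  sumℕ-last K f = begin
    ∑ℕ[ k < suc K ] f k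
      ≈⟨ sum-init-last (f ∘ toℕ) ⟩
    ∑[ i < K ] f (toℕ (inject₁ i)) + f (toℕ (fromℕ K))
      ≡⟨ ≡.cong₂ _+_ (sum-cong-≗ {K} {f ∘ toℕ ∘ inject₁} {f ∘ toℕ} (≡.cong f ∘ toℕ-inject₁))
                     (≡.cong f (toℕ-fromℕ K)) ⟩
    ∑ℕ[ k < K ] f k + f K ∎

  ∑ℕ-distrib-+ : ∀ K (f g : ℕ → Carrier) → ∑ℕ[ k < K ] (f k + g k) ≈ ∑ℕ[ k < K ] f k + ∑ℕ[ k < K ] g k
  ∑ℕ-distrib-+ K f g = ∑-distrib-+ {K} (f ∘ toℕ) (g ∘ toℕ)

  *-distribˡ-∑ℕ : ∀ K x (f : ℕ → Carrier) → x * ∑ℕ[ k < K ] f k ≈ ∑ℕ[ k < K ] (x * f k)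
  *-distribˡ-∑ℕ K x f = *-distribˡ-sum {K} x (f ∘ toℕ)

  ∑ℕ-sub : ∀ K (f g : ℕ → Carrier) → ∑ℕ[ k < K ] (f k - g k) ≈ ∑ℕ[ k < K ] f k - ∑ℕ[ k < K ] g k
  ∑ℕ-sub K f g = trans (∑ℕ-distrib-+ K f (λ k → - g k)) (+-congˡ (∑ℕ-neg K g))
    where
    ∑ℕ-neg : ∀ K (g : ℕ → Carrier) → ∑ℕ[ k < K ] (- g k) ≈ - ∑ℕ[ k < K ] g k
    ∑ℕ-neg zero    g = sym -0#≈0#
    ∑ℕ-neg (suc K) g = trans (+-congˡ (∑ℕ-neg K (g ∘ suc))) (-‿+-comm (g 0) (∑ℕ[ k < K ] g (suc k)))

  ∑-const : ∀ n x → ∑[ j < n ] x ≈ cast n * x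
  ∑-const zero    x = sym (zeroˡ x)
  ∑-const (suc n) x = trans (+-cong (sym (*-identityˡ x)) (∑-const n x)) (sym (distribʳ x 1# (cast n)))

  foldr-allFin : ∀ {n} (_∙_ : Carrier → Carrier → Carrier) ε (f : Vector Carrier n) →
                 List.foldr _∙_ ε (List.map f (allFin n)) ≡ Vector.foldr _∙_ ε f
  foldr-allFin _∙_ ε f = ≡.trans (≡.cong (List.foldr _∙_ ε) (map-tabulate id f)) (foldr-tabulate f)
    where
    foldr-tabulate : ∀ {n} (f : Vector Carrier n) → List.foldr _∙_ ε (tabulate f) ≡ Vector.foldr _∙_ ε f
    foldr-tabulate {zero}  f = ≡.refl
    foldr-tabulate {suc n} f = ≡.cong (f zero ∙_) (foldr-tabulate (f ∘ suc))

  Σ≡sum : ∀ {n} (f : Vector Carrier n) → Σ[_] R f ≡ sum f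
  Σ≡sum = foldr-allFin _+_ 0#

  -- Elementary symmetric polynomials

  e : ∀ {n} → ℕ → Vector Carrier n → Carrier
  e k x = esymL R k (tabulate x)

  esym≡e : ∀ {n} k (x : Vector Carrier n) → esym R k x ≡ e k x
  esym≡e k x = ≡.cong (esymL R k) (map-tabulate id x)

  e-vanish : ∀ {n} k (x : Vector Carrier n) → n < k → e k x ≈ 0#
  e-vanish {zero}  (suc k) x n<k = refl
  e-vanish {suc n} (suc k) x (s≤s n<k) = begin
    x zero * e k (x ∘ suc) + e (suc k) (x ∘ suc)
      ≈⟨ +-cong (*-congˡ (e-vanish k (x ∘ suc) n<k)) (e-vanish (suc k) (x ∘ suc) (m≤n⇒m≤1+n n<k)) ⟩
    x zero * 0# + 0#
      ≈⟨ solve 1 (λ a → a :* con 0 :+ con 0 := con 0) refl (x zero) ⟩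
    0# ∎

  e-punchIn : ∀ {n} k (x : Vector Carrier (suc n)) i →
              e (suc k) x ≈ x i * e k (x ∘ punchIn i) + e (suc k) (x ∘ punchIn i)
  e-punchIn k x zero = refl
  e-punchIn {suc n} zero x (suc i) = begin
    x₀ * 1# + e 1 (x ∘ suc)       ≈⟨ +-congˡ (e-punchIn zero (x ∘ suc) i) ⟩
    x₀ * 1# + (xᵢ * 1# + e 1 x′)  ≈⟨ solve 3 (λ a b c → a :* con 1 :+ (b :* con 1 :+ c) := b :* con 1 :+ (a :* con 1 :+ c))
                                            refl x₀ xᵢ (e 1 x′) ⟩
    xᵢ * 1# + (x₀ * 1# + e 1 x′)  ∎
    where x₀ = x zero; xᵢ = x (suc i); x′ = x ∘ suc ∘ punchIn i
  e-punchIn {suc n} (suc k) x (suc i) = begin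
    x₀ * e (suc k) (x ∘ suc) + e (suc (suc k)) (x ∘ suc)
      ≈⟨ +-cong (*-congˡ (e-punchIn k (x ∘ suc) i)) (e-punchIn (suc k) (x ∘ suc) i) ⟩
    x₀ * (xᵢ * e k x′ + e (suc k) x′) + (xᵢ * e (suc k) x′ + e (suc (suc k)) x′)
      ≈⟨ solve 5 (λ a b u v w → a :* (b :* u :+ v) :+ (b :* v :+ w) := b :* (a :* u :+ v) :+ (a :* v :+ w))
                 refl x₀ xᵢ (e k x′) (e (suc k) x′) (e (suc (suc k)) x′) ⟩
    xᵢ * (x₀ * e k x′ + e (suc k) x′) + (x₀ * e (suc k) x′ + e (suc (suc k)) x′) ∎
    where x₀ = x zero; xᵢ = x (suc i); x′ = x ∘ suc ∘ punchIn i

  adjoin : Carrier → (ℕ → Carrier) → ℕ → Carrier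
  adjoin p a zero    = a zero
  adjoin p a (suc k) = p * a k + a (suc k)

  e-adjoin : ∀ {n} k (x : Vector Carrier (suc n)) i → e k x ≈ adjoin (x i) (λ k → e k (x ∘ punchIn i)) k
  e-adjoin zero    x i = refl
  e-adjoin (suc k) x i = e-punchIn k x i

  ∑-*-e-punchIn : ∀ {N} k (z : Vector Carrier (suc N)) →
                  ∑[ j < suc N ] (z j * e k (z ∘ punchIn j)) ≈ cast (suc k) * e (suc k) z
  ∑-*-e-punchIn {zero} zero z =
    solve 1 (λ a → a :* con 1 :+ con 0 := (con 1 :+ con 0) :* (a :* con 1 :+ con 0)) refl (z zero)
  ∑-*-e-punchIn {zero} (suc k) z =
    solve 2 (λ a c → a :* con 0 :+ con 0 := c :* (a :* con 0 :+ con 0)) refl (z zero) (cast (suc (suc k)))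
  ∑-*-e-punchIn {suc N} zero z = begin
    z₀ * 1# + ∑[ j < suc N ] (z′ j * 1#)  ≈⟨ +-congˡ (∑-*-e-punchIn zero z′) ⟩
    z₀ * 1# + cast 1 * e 1 z′             ≈⟨ solve 2 (λ a E → a :* con 1 :+ (con 1 :+ con 0) :* E
                                                            := (con 1 :+ con 0) :* (a :* con 1 :+ E))
                                                     refl z₀ (e 1 z′) ⟩
    cast 1 * (z₀ * 1# + e 1 z′)           ∎
    where z₀ = z zero; z′ = z ∘ suc
  ∑-*-e-punchIn {suc N} (suc k) z = begin
    z₀ * E + ∑[ j < suc N ] (z′ j * (z₀ * e k (z′ ∘ punchIn j) + e (suc k) (z′ ∘ punchIn j)))
      ≈⟨ +-congˡ (sum-cong-≋ λ j → solve 4 (λ z a u v → z :* (a :* u :+ v) := a :* (z :* u) :+ z :* v)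
                                             refl (z′ j) z₀ (e k (z′ ∘ punchIn j)) (e (suc k) (z′ ∘ punchIn j))) ⟩
    z₀ * E + ∑[ j < suc N ] (z₀ * u j + v j)
      ≈⟨ +-congˡ (trans (∑-distrib-+ (λ j → z₀ * u j) v) (+-congʳ (sym (*-distribˡ-sum z₀ u)))) ⟩
    z₀ * E + (z₀ * ∑[ j < suc N ] u j + ∑[ j < suc N ] v j)
      ≈⟨ +-congˡ (+-cong (*-congˡ (∑-*-e-punchIn k z′)) (∑-*-e-punchIn (suc k) z′)) ⟩
    z₀ * E + (z₀ * (c * E) + (1# + c) * F)
      ≈⟨ solve 4 (λ z E F c → z :* E :+ (z :* (c :* E) :+ (con 1 :+ c) :* F) := (con 1 :+ c) :* (z :* E :+ F))
                 refl z₀ E F c ⟩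
    (1# + c) * (z₀ * E + F) ∎
    where
    z₀ = z zero; z′ = z ∘ suc; E = e (suc k) z′; F = e (suc (suc k)) z′; c = cast (suc k)
    u v : Vector Carrier (suc N)
    u j = z′ j * e k (z′ ∘ punchIn j)
    v j = z′ j * e (suc k) (z′ ∘ punchIn j)

  -- Sum e-punchIn over j and cancel the part computed by ∑-*-e-punchIn.
  ∑-e-punchIn : ∀ {N} k (z : Vector Carrier (suc N)) →
                ∑[ j < suc N ] e k (z ∘ punchIn j) ≈ cast (suc N ∸ k) * e k z
  ∑-e-punchIn {N} zero z = ∑-const (suc N) 1#
  ∑-e-punchIn {N} (suc k) z with suc k ≤? suc N
  ... | yes k<N = +-cancelˡ (cast (suc k) * E) _ _ (begin
    cast (suc k) * E + sum deleted                ≈⟨ +-congʳ (sym (∑-*-e-punchIn k z)) ⟩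
    sum weighted + sum deleted                    ≈⟨ sym (∑-distrib-+ weighted deleted) ⟩
    ∑[ j < suc N ] (weighted j + deleted j)       ≈⟨ sum-cong-≋ (λ j → sym (e-punchIn k z j)) ⟩
    ∑[ j < suc N ] E                              ≈⟨ ∑-const (suc N) E ⟩
    cast (suc N) * E                              ≈⟨ *-congʳ (cast-cong (≡.sym (m+[n∸m]≡n k<N))) ⟩
    cast (suc k Data.Nat.+ (suc N ∸ suc k)) * E   ≈⟨ *-congʳ (×-homo-+ 1# (suc k) (suc N ∸ suc k)) ⟩
    (cast (suc k) + cast (suc N ∸ suc k)) * E     ≈⟨ distribʳ E _ _ ⟩
    cast (suc k) * E + cast (suc N ∸ suc k) * E   ∎)
    where
    E = e (suc k) z
    weighted deleted : Vector Carrier (suc N)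
    weighted j = z j * e k (z ∘ punchIn j)
    deleted  j = e (suc k) (z ∘ punchIn j)
  ... | no k≮N = begin
    ∑[ j < suc N ] e (suc k) (z ∘ punchIn j)  ≈⟨ sum-cong-≋ (λ j → e-vanish (suc k) (z ∘ punchIn j) (<⇒≤ N<k)) ⟩
    ∑[ j < suc N ] 0#                         ≈⟨ ∑-const (suc N) 0# ⟩
    cast (suc N) * 0#                         ≈⟨ zeroʳ _ ⟩
    0#                                        ≈⟨ zeroˡ _ ⟨
    0# * e (suc k) z                          ≈⟨ *-congʳ (cast-cong (≡.sym (m≤n⇒m∸n≡0 (<⇒≤ N<k)))) ⟩
    cast (suc N ∸ suc k) * e (suc k) z        ∎
    where N<k = ≰⇒> k≮N

  -- Permanents

  𝟙 : Bool → Carrier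
  𝟙 true  = 1#
  𝟙 false = 0#

  𝟙-cong : ∀ {x y} → x ≡ y → 𝟙 x ≈ 𝟙 y
  𝟙-cong ≡.refl = refl

  𝟙-∧ : ∀ x y → 𝟙 (x ∧ y) ≈ 𝟙 x * 𝟙 y
  𝟙-∧ true  y = sym (*-identityˡ (𝟙 y))
  𝟙-∧ false y = sym (zeroˡ (𝟙 y))

  ∑L : {A : Set} → (A → Carrier) → List A → Carrier
  ∑L h xs = sumL R (List.map h xs)

  ∑L-cong : {A : Set} {g h : A → Carrier} (xs : List A) → (∀ x → g x ≈ h x) → ∑L g xs ≈ ∑L h xs
  ∑L-cong []       g≈h = refl
  ∑L-cong (x ∷ xs) g≈h = +-cong (g≈h x) (∑L-cong xs g≈h)

  ∑L-++ : {A : Set} (h : A → Carrier) (xs ys : List A) → ∑L h (xs List.++ ys) ≈ ∑L h xs + ∑L h ys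
  ∑L-++ h []       ys = sym (+-identityˡ _)
  ∑L-++ h (x ∷ xs) ys = trans (+-congˡ (∑L-++ h xs ys)) (sym (+-assoc _ _ _))

  ∑L-concatMap : {A B : Set} (h : B → Carrier) (g : A → List B) (xs : List A) →
                 ∑L h (List.concatMap g xs) ≈ ∑L (λ x → ∑L h (g x)) xs
  ∑L-concatMap h g []       = refl
  ∑L-concatMap h g (x ∷ xs) = trans (∑L-++ h (g x) _) (+-congˡ (∑L-concatMap h g xs))

  *-distribˡ-∑L : {A : Set} (a : Carrier) (h : A → Carrier) (xs : List A) → a * ∑L h xs ≈ ∑L (λ x → a * h x) xs
  *-distribˡ-∑L a h []       = zeroʳ a
  *-distribˡ-∑L a h (x ∷ xs) = trans (distribˡ a _ _) (+-congˡ (*-distribˡ-∑L a h xs))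

  ∑L-comm : {A : Set} {n : ℕ} (g : A → Fin n → Carrier) (xs : List A) →
            ∑L (λ x → ∑[ j < n ] g x j) xs ≈ ∑[ j < n ] ∑L (λ x → g x j) xs
  ∑L-comm {n = n} g []       = sym (sum-replicate-zero n)
  ∑L-comm         g (x ∷ xs) = trans (+-congˡ (∑L-comm g xs)) (sym (∑-distrib-+ (g x) _))

  ∑L-filter : {A : Set} (b : A → Bool) (h : A → Carrier) (xs : List A) →
              ∑L h (List.filter (λ x → b x Data.Bool.≟ true) xs) ≈ ∑L (λ x → 𝟙 (b x) * h x) xs
  ∑L-filter b h []       = refl
  ∑L-filter b h (x ∷ xs) with b x
  ... | true  = +-cong (sym (*-identityˡ _)) (∑L-filter b h xs)
  ... | false = trans (∑L-filter b h xs) (sym (trans (+-congʳ (zeroˡ _)) (+-identityˡ _)))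

  ∑-skip : ∀ {k} (j : Fin (suc k)) (g : Vector Carrier (suc k)) →
           ∑[ j′ < suc k ] (𝟙 (not ⌊ j′ ≟ j ⌋) * g j′) ≈ ∑[ j′ < k ] g (punchIn j j′)
  ∑-skip {k} j g = begin
    ∑[ j′ < suc k ] (𝟙 (not ⌊ j′ ≟ j ⌋) * g j′)
      ≈⟨ sum-remove {i = j} (λ j′ → 𝟙 (not ⌊ j′ ≟ j ⌋) * g j′) ⟩
    𝟙 (not ⌊ j ≟ j ⌋) * g j + ∑[ j′ < k ] (𝟙 (not ⌊ punchIn j j′ ≟ j ⌋) * g (punchIn j j′))
      ≈⟨ +-cong at-j (sum-cong-≋ off-j) ⟩
    0# + ∑[ j′ < k ] g (punchIn j j′)
      ≈⟨ +-identityˡ _ ⟩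
    ∑[ j′ < k ] g (punchIn j j′) ∎
    where
    at-j : 𝟙 (not ⌊ j ≟ j ⌋) * g j ≈ 0#
    at-j with j ≟ j
    ... | yes _  = zeroˡ (g j)
    ... | no j≢j = ⊥-elim (j≢j ≡.refl)

    off-j : ∀ j′ → 𝟙 (not ⌊ punchIn j j′ ≟ j ⌋) * g (punchIn j j′) ≈ g (punchIn j j′)
    off-j j′ with punchIn j j′ ≟ j
    ... | yes eq = ⊥-elim (punchInᵢ≢i j j′ eq)
    ... | no _   = *-identityˡ (g (punchIn j j′))

  ∑fun : ∀ m k → ((Fin m → Fin k) → Carrier) → Carrier
  ∑fun m k h = ∑L h (allFuns m k)

  -- allFuns builds its maps with a local cons, which agrees with j ∷ f only pointwise.
  ∑fun-suc : ∀ m k (h : (Fin (suc m) → Fin k) → Carrier) → h Preserves _≗_ ⟶ _≈_ →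
             ∑fun (suc m) k h ≈ ∑fun m k (λ f → ∑[ j < k ] h (j Vector.∷ f))
  ∑fun-suc m k h h-cong = trans (∑L-concatMap h _ (allFuns m k)) (∑L-cong (allFuns m k) λ f →
    trans (reflexive (≡.trans (≡.cong (sumL R) (≡.sym (map-∘ (allFin k)))) (foldr-allFin {k} _+_ 0# _)))
          (sum-cong-≋ {k} λ j → h-cong λ { zero → ≡.refl ; (suc i) → ≡.refl }))

  ∑-injective-avoiding : ∀ m k (j : Fin (suc k)) (h : (Fin m → Fin (suc k)) → Carrier) → h Preserves _≗_ ⟶ _≈_ →
                         ∑fun m (suc k) (λ f → 𝟙 (injective? f ∧ avoids? j f) * h f)
                         ≈ ∑fun m k (λ f → 𝟙 (injective? f) * h (punchIn j ∘ f))
  ∑-injective-avoiding zero    k j h h-cong = +-congʳ (*-congˡ (h-cong λ ()))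
  ∑-injective-avoiding (suc m) k j h h-cong = begin
    ∑fun (suc m) (suc k) (λ f → 𝟙 (injective? f ∧ avoids? j f) * h f)
      ≈⟨ ∑fun-suc m (suc k) _ (λ f≗g →
           *-cong (𝟙-cong (≡.cong₂ _∧_ (injective?-cong f≗g) (avoids?-cong j f≗g))) (h-cong f≗g)) ⟩
    ∑fun m (suc k) (λ f → ∑[ j′ < suc k ] (𝟙 (both f j′) * h (j′ Vector.∷ f)))
      ≈⟨ ∑L-cong (allFuns m (suc k)) split ⟩
    ∑fun m (suc k) (λ f → 𝟙 (injective? f ∧ avoids? j f) * G f)
      ≈⟨ ∑-injective-avoiding m k j G G-cong ⟩
    ∑fun m k (λ f → 𝟙 (injective? f) * G (punchIn j ∘ f))
      ≈⟨ ∑L-cong (allFuns m k) join ⟩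
    ∑fun m k (λ f → ∑[ j′ < k ] (𝟙 (avoids? j′ f ∧ injective? f) * h (punchIn j ∘ (j′ Vector.∷ f))))
      ≈⟨ ∑fun-suc m k _ (λ f≗g → *-cong (𝟙-cong (injective?-cong f≗g)) (h-cong (≡.cong (punchIn j) ∘ f≗g))) ⟨
    ∑fun (suc m) k (λ f → 𝟙 (injective? f) * h (punchIn j ∘ f)) ∎
    where
    both : (Fin m → Fin (suc k)) → Fin (suc k) → Bool
    both f j′ = (avoids? j′ f ∧ injective? f) ∧ (not ⌊ j′ ≟ j ⌋ ∧ avoids? j f)

    H : (Fin m → Fin (suc k)) → Fin (suc k) → Carrier
    H f j′ = 𝟙 (avoids? j′ f) * h (j′ Vector.∷ f)

    G : (Fin m → Fin (suc k)) → Carrier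
    G f = ∑[ j′ < suc k ] (𝟙 (not ⌊ j′ ≟ j ⌋) * H f j′)

    ∷-cong : ∀ j′ {f g : Fin m → Fin (suc k)} → f ≗ g → (j′ Vector.∷ f) ≗ (j′ Vector.∷ g)
    ∷-cong j′ f≗g zero    = ≡.refl
    ∷-cong j′ f≗g (suc i) = f≗g i

    G-cong : G Preserves _≗_ ⟶ _≈_
    G-cong f≗g = sum-cong-≋ λ j′ →
      *-congˡ {𝟙 (not ⌊ j′ ≟ j ⌋)} (*-cong (𝟙-cong (avoids?-cong j′ f≗g)) (h-cong (∷-cong j′ f≗g)))

    split : ∀ f → ∑[ j′ < suc k ] (𝟙 (both f j′) * h (j′ Vector.∷ f)) ≈ 𝟙 (injective? f ∧ avoids? j f) * G f
    split f = begin
      ∑[ j′ < suc k ] (𝟙 (both f j′) * h (j′ Vector.∷ f))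
        ≈⟨ sum-cong-≋ (λ j′ → regroup (avoids? j′ f) (injective? f) (not ⌊ j′ ≟ j ⌋) (avoids? j f) (h (j′ Vector.∷ f))) ⟩
      ∑[ j′ < suc k ] (𝟙 (injective? f ∧ avoids? j f) * (𝟙 (not ⌊ j′ ≟ j ⌋) * H f j′))
        ≈⟨ *-distribˡ-sum (𝟙 (injective? f ∧ avoids? j f)) (λ j′ → 𝟙 (not ⌊ j′ ≟ j ⌋) * H f j′) ⟨
      𝟙 (injective? f ∧ avoids? j f) * G f ∎
      where
      regroup : ∀ a i c v x → 𝟙 ((a ∧ i) ∧ (c ∧ v)) * x ≈ 𝟙 (i ∧ v) * (𝟙 c * (𝟙 a * x))
      regroup a i c v x = begin
        𝟙 ((a ∧ i) ∧ (c ∧ v)) * x        ≈⟨ *-congʳ (trans (𝟙-∧ (a ∧ i) (c ∧ v)) (*-cong (𝟙-∧ a i) (𝟙-∧ c v))) ⟩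
        (𝟙 a * 𝟙 i) * (𝟙 c * 𝟙 v) * x    ≈⟨ solve 5 (λ a i c v x → (a :* i) :* (c :* v) :* x := (i :* v) :* (c :* (a :* x)))
                                                   refl (𝟙 a) (𝟙 i) (𝟙 c) (𝟙 v) x ⟩
        (𝟙 i * 𝟙 v) * (𝟙 c * (𝟙 a * x))  ≈⟨ *-congʳ (𝟙-∧ i v) ⟨
        𝟙 (i ∧ v) * (𝟙 c * (𝟙 a * x))    ∎

    join : ∀ f → 𝟙 (injective? f) * G (punchIn j ∘ f)
               ≈ ∑[ j′ < k ] (𝟙 (avoids? j′ f ∧ injective? f) * h (punchIn j ∘ (j′ Vector.∷ f)))
    join f = begin
      𝟙 (injective? f) * G (punchIn j ∘ f)
        ≈⟨ *-congˡ (∑-skip j (H (punchIn j ∘ f))) ⟩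
      𝟙 (injective? f) * ∑[ j′ < k ] H (punchIn j ∘ f) (punchIn j j′)
        ≈⟨ *-congˡ (sum-cong-≋ λ j′ →
             *-cong (𝟙-cong (avoids?-punchIn j j′ f)) (h-cong λ { zero → ≡.refl ; (suc i) → ≡.refl })) ⟩
      𝟙 (injective? f) * ∑[ j′ < k ] (𝟙 (avoids? j′ f) * h (punchIn j ∘ (j′ Vector.∷ f)))
        ≈⟨ *-distribˡ-sum (𝟙 (injective? f)) (λ j′ → 𝟙 (avoids? j′ f) * h (punchIn j ∘ (j′ Vector.∷ f))) ⟩
      ∑[ j′ < k ] (𝟙 (injective? f) * (𝟙 (avoids? j′ f) * h (punchIn j ∘ (j′ Vector.∷ f))))
        ≈⟨ sum-cong-≋ (λ j′ → merge (injective? f) (avoids? j′ f) (h (punchIn j ∘ (j′ Vector.∷ f)))) ⟩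
      ∑[ j′ < k ] (𝟙 (avoids? j′ f ∧ injective? f) * h (punchIn j ∘ (j′ Vector.∷ f))) ∎
      where
      merge : ∀ i a x → 𝟙 i * (𝟙 a * x) ≈ 𝟙 (a ∧ i) * x
      merge i a x = trans (solve 3 (λ i a x → i :* (a :* x) := (a :* i) :* x) refl (𝟙 i) (𝟙 a) x)
                          (*-congʳ (sym (𝟙-∧ a i)))

  rectPer : ∀ {m k} → (Fin m → Fin k → Carrier) → Carrier
  rectPer {m} {k} B = ∑fun m k (λ f → 𝟙 (injective? f) * ∏ (λ i → B i (f i)))

  rectPer-cong : ∀ {m k} {A B : Fin m → Fin k → Carrier} → (∀ i j → A i j ≈ B i j) → rectPer A ≈ rectPer B
  rectPer-cong {m} {k} A≈B = ∑L-cong (allFuns m k) λ f → *-congˡ (∏-cong λ i → A≈B i (f i))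

  rectPer-expand : ∀ {m k} (B : Fin (suc m) → Fin (suc k) → Carrier) →
                   rectPer B ≈ ∑[ j < suc k ] (B zero j * rectPer (λ r s → B (suc r) (punchIn j s)))
  rectPer-expand {m} {k} B = begin
    rectPer B
      ≈⟨ ∑fun-suc m (suc k) _ (λ f≗g → *-cong (𝟙-cong (injective?-cong f≗g)) (∏-cong λ i → reflexive (≡.cong (B i) (f≗g i)))) ⟩
    ∑fun m (suc k) (λ f → ∑[ j < suc k ] (𝟙 (avoids? j f ∧ injective? f) * (B zero j * P f)))
      ≈⟨ ∑L-cong (allFuns m (suc k)) (λ f → sum-cong-≋ λ j → reorder (avoids? j f) (injective? f) (B zero j) (P f)) ⟩
    ∑fun m (suc k) (λ f → ∑[ j < suc k ] (B zero j * Q j f))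
      ≈⟨ ∑L-comm (λ f j → B zero j * Q j f) (allFuns m (suc k)) ⟩
    ∑[ j < suc k ] ∑fun m (suc k) (λ f → B zero j * Q j f)
      ≈⟨ sum-cong-≋ (λ j → *-distribˡ-∑L (B zero j) (Q j) (allFuns m (suc k))) ⟨
    ∑[ j < suc k ] (B zero j * ∑fun m (suc k) (Q j))
      ≈⟨ sum-cong-≋ (λ j → *-congˡ {B zero j} (∑-injective-avoiding m k j P P-cong)) ⟩
    ∑[ j < suc k ] (B zero j * rectPer (λ r s → B (suc r) (punchIn j s))) ∎
    where
    P : (Fin m → Fin (suc k)) → Carrier
    P f = ∏ (λ i → B (suc i) (f i))

    Q : Fin (suc k) → (Fin m → Fin (suc k)) → Carrier
    Q j f = 𝟙 (injective? f ∧ avoids? j f) * P f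

    P-cong : P Preserves _≗_ ⟶ _≈_
    P-cong f≗g = ∏-cong λ i → reflexive (≡.cong (B (suc i)) (f≗g i))

    reorder : ∀ a i b x → 𝟙 (a ∧ i) * (b * x) ≈ b * (𝟙 (i ∧ a) * x)
    reorder a i b x = begin
      𝟙 (a ∧ i) * (b * x)  ≈⟨ *-congʳ (𝟙-∧ a i) ⟩
      𝟙 a * 𝟙 i * (b * x)  ≈⟨ solve 4 (λ a i b x → a :* i :* (b :* x) := b :* (i :* a :* x)) refl (𝟙 a) (𝟙 i) b x ⟩
      b * (𝟙 i * 𝟙 a * x)  ≈⟨ *-congˡ (*-congʳ (𝟙-∧ i a)) ⟨
      b * (𝟙 (i ∧ a) * x)  ∎

  per≈rectPer : ∀ {n} (A : Matrix Carrier n) → per R A ≈ rectPer A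
  per≈rectPer {n} A = begin
    per R A
      ≈⟨ ∑L-filter isInjective (λ σ → Π[_] R (λ i → A i (σ i))) (allFuns n n) ⟩
    ∑L (λ σ → 𝟙 (isInjective σ) * Π[_] R (λ i → A i (σ i))) (allFuns n n)
      ≈⟨ ∑L-cong (allFuns n n) (λ σ → reflexive (≡.cong₂ (λ b p → 𝟙 b * p)
                                   (isInjective≡injective? σ) (foldr-allFin _*_ 1# (λ i → A i (σ i))))) ⟩
    rectPer A ∎

  per-cong : ∀ {n} {A B : Matrix Carrier n} → (∀ i j → A i j ≈ B i j) → per R A ≈ per R B
  per-cong {A = A} {B} A≈B = trans (per≈rectPer A) (trans (rectPer-cong A≈B) (sym (per≈rectPer B)))

  per-expand : ∀ {n} (A : Matrix Carrier (suc n)) → per R A ≈ ∑[ j < suc n ] (A zero j * per R (minor R A zero j))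
  per-expand A = trans (per≈rectPer A) (trans (rectPer-expand A)
    (sum-cong-≋ λ j → *-congˡ {A zero j} (sym (per≈rectPer (minor R A zero j)))))

  onePlusOuter : ∀ {n} → Vector Carrier n → Vector Carrier n → Matrix Carrier n
  onePlusOuter y z r s = 1# + y r * z s

  per-onePlusOuter : ∀ N (y z : Vector Carrier N) →
                     per R (onePlusOuter y z) ≈ ∑ℕ[ k < suc N ] (cast (fac N k) * (e k y * e k z))
  per-onePlusOuter zero y z = solve 0 (con 1 :+ con 0 := (con 1 :+ con 0) :* (con 1 :* con 1) :+ con 0) refl
  per-onePlusOuter (suc N) y z = begin
    per R (onePlusOuter y z)
      ≈⟨ per-expand (onePlusOuter y z) ⟩
    ∑[ j < suc N ] ((1# + y₀ * z j) * per R (onePlusOuter y′ (z ∘ punchIn j)))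
      ≈⟨ sum-cong-≋ {suc N} expand ⟩
    ∑[ j < suc N ] (∑ℕ[ k < suc N ] T j k)
      ≈⟨ ∑-comm {suc N} {suc N} (λ j i → T j (toℕ i)) ⟩
    ∑ℕ[ k < suc N ] (∑[ j < suc N ] T j k)
      ≈⟨ sumℕ-cong (suc N) (λ k k<N → collect k (≤-pred k<N)) ⟩
    ∑ℕ[ k < suc N ] (α′ k * (Y k * Z k) + α′ (suc k) * (y₀ * Y k * Z (suc k)))
      ≈⟨ ∑ℕ-distrib-+ (suc N) (λ k → α′ k * (Y k * Z k)) (λ k → α′ (suc k) * (y₀ * Y k * Z (suc k))) ⟩
    (α′ 0 * (1# * Z 0) + top) + shifted
      ≈⟨ solve 3 (λ c t s → (c :+ t) :+ s := c :+ (s :+ t)) refl (α′ 0 * (1# * Z 0)) top shifted ⟩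
    α′ 0 * (1# * Z 0) + (shifted + top)
      ≈⟨ +-congˡ (+-congˡ top-extend) ⟨
    α′ 0 * (1# * Z 0) + (shifted + ∑ℕ[ k < suc N ] (α′ (suc k) * (Y (suc k) * Z (suc k))))
      ≈⟨ +-congˡ (∑ℕ-distrib-+ (suc N) (λ k → α′ (suc k) * (y₀ * Y k * Z (suc k)))
                                        (λ k → α′ (suc k) * (Y (suc k) * Z (suc k)))) ⟨
    α′ 0 * (1# * Z 0) + ∑ℕ[ k < suc N ] (α′ (suc k) * (y₀ * Y k * Z (suc k)) + α′ (suc k) * (Y (suc k) * Z (suc k)))
      ≈⟨ +-congˡ (sumℕ-cong (suc N) λ k _ → regroup k) ⟩
    ∑ℕ[ k < suc (suc N) ] (α′ k * (e k y * Z k)) ∎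
    where
    y₀ = y zero
    y′ = y ∘ suc
    α α′ Y Z : ℕ → Carrier
    α k = cast (fac N k)
    α′ k = cast (fac (suc N) k)
    Y k = e k y′
    Z k = e k z

    T : Fin (suc N) → ℕ → Carrier
    T j k = α k * Y k * e k (z ∘ punchIn j) + α k * Y k * y₀ * (z j * e k (z ∘ punchIn j))

    expand : ∀ j → (1# + y₀ * z j) * per R (onePlusOuter y′ (z ∘ punchIn j)) ≈ ∑ℕ[ k < suc N ] T j k
    expand j = begin
      (1# + y₀ * z j) * per R (onePlusOuter y′ (z ∘ punchIn j))
        ≈⟨ *-congˡ (per-onePlusOuter N y′ (z ∘ punchIn j)) ⟩
      (1# + y₀ * z j) * ∑ℕ[ k < suc N ] (α k * (Y k * e k (z ∘ punchIn j)))
        ≈⟨ *-distribˡ-∑ℕ (suc N) (1# + y₀ * z j) (λ k → α k * (Y k * e k (z ∘ punchIn j))) ⟩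
      ∑ℕ[ k < suc N ] ((1# + y₀ * z j) * (α k * (Y k * e k (z ∘ punchIn j))))
        ≈⟨ sumℕ-cong (suc N) (λ k _ → multiply-out k) ⟩
      ∑ℕ[ k < suc N ] T j k ∎
      where
      multiply-out : ∀ k → (1# + y₀ * z j) * (α k * (Y k * e k (z ∘ punchIn j))) ≈ T j k
      multiply-out k = solve 5 (λ y₀ zj a Y E → (con 1 :+ y₀ :* zj) :* (a :* (Y :* E))
                                               := a :* Y :* E :+ a :* Y :* y₀ :* (zj :* E))
                               refl y₀ (z j) (α k) (Y k) (e k (z ∘ punchIn j))

    collect : ∀ k → k ≤ N → ∑[ j < suc N ] T j k ≈ α′ k * (Y k * Z k) + α′ (suc k) * (y₀ * Y k * Z (suc k))
    collect k k≤N = begin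
      ∑[ j < suc N ] T j k
        ≈⟨ ∑-distrib-+ {suc N} (λ j → α k * Y k * e k (z ∘ punchIn j))
                                (λ j → α k * Y k * y₀ * (z j * e k (z ∘ punchIn j))) ⟩
      ∑[ j < suc N ] (α k * Y k * e k (z ∘ punchIn j)) + ∑[ j < suc N ] (α k * Y k * y₀ * (z j * e k (z ∘ punchIn j)))
        ≈⟨ +-cong (*-distribˡ-sum {suc N} (α k * Y k) (λ j → e k (z ∘ punchIn j)))
                  (*-distribˡ-sum {suc N} (α k * Y k * y₀) (λ j → z j * e k (z ∘ punchIn j))) ⟨
      α k * Y k * (∑[ j < suc N ] e k (z ∘ punchIn j)) + α k * Y k * y₀ * (∑[ j < suc N ] (z j * e k (z ∘ punchIn j)))
        ≈⟨ +-cong (*-congˡ (∑-e-punchIn k z)) (*-congˡ (∑-*-e-punchIn k z)) ⟩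
      α k * Y k * (cast (suc N ∸ k) * Z k) + α k * Y k * y₀ * (cast (suc k) * Z (suc k))
        ≈⟨ +-cong (solve 4 (λ a Y c Z → a :* Y :* (c :* Z) := a :* c :* (Y :* Z))
                           refl (α k) (Y k) (cast (suc N ∸ k)) (Z k))
                  (solve 5 (λ a Y y c Z → a :* Y :* y :* (c :* Z) := a :* c :* (y :* Y :* Z))
                           refl (α k) (Y k) y₀ (cast (suc k)) (Z (suc k))) ⟩
      α k * cast (suc N ∸ k) * (Y k * Z k) + α k * cast (suc k) * (y₀ * Y k * Z (suc k))
        ≈⟨ +-cong (*-congʳ (cast-fac-∸ k≤N)) (*-congʳ (cast-fac-suc N k)) ⟩
      α′ k * (Y k * Z k) + α′ (suc k) * (y₀ * Y k * Z (suc k)) ∎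

    top shifted : Carrier
    top = ∑ℕ[ k < N ] (α′ (suc k) * (Y (suc k) * Z (suc k)))
    shifted = ∑ℕ[ k < suc N ] (α′ (suc k) * (y₀ * Y k * Z (suc k)))

    top-extend : ∑ℕ[ k < suc N ] (α′ (suc k) * (Y (suc k) * Z (suc k))) ≈ top
    top-extend = begin
      ∑ℕ[ k < suc N ] (α′ (suc k) * (Y (suc k) * Z (suc k)))
        ≈⟨ sumℕ-last N (λ k → α′ (suc k) * (Y (suc k) * Z (suc k))) ⟩
      top + α′ (suc N) * (Y (suc N) * Z (suc N))
        ≈⟨ +-congˡ (*-congˡ (*-congʳ (e-vanish (suc N) y′ ≤-refl))) ⟩
      top + α′ (suc N) * (0# * Z (suc N))
        ≈⟨ solve 3 (λ t a Z → t :+ a :* (con 0 :* Z) := t) refl top (α′ (suc N)) (Z (suc N)) ⟩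
      top ∎

    regroup : ∀ k → α′ (suc k) * (y₀ * Y k * Z (suc k)) + α′ (suc k) * (Y (suc k) * Z (suc k))
                    ≈ α′ (suc k) * ((y₀ * Y k + Y (suc k)) * Z (suc k))
    regroup k = solve 5 (λ a y Y Y′ Z → a :* (y :* Y :* Z) :+ a :* (Y′ :* Z) := a :* ((y :* Y :+ Y′) :* Z))
                        refl (α′ (suc k)) y₀ (Y k) (Y (suc k)) (Z (suc k))

  -- The polynomial identity

  -- Entries instantiates p = x_i, q = x̄_j and a, b as the e_k with x_i resp. x̄_j deleted;
  -- then v p a k is the i-th entry of the paper's v_{k+1}, and δ k is n times its coefficient.
  module CofactorIdentity (m : ℕ) (p q : Carrier) (a b : ℕ → Carrier)
                          (a-vanish : a (suc (suc m)) ≈ 0#) (b-vanish : b (suc (suc m)) ≈ 0#) where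
    N n : ℕ
    N = suc m
    n = suc N

    α γ δ s t A : ℕ → Carrier
    α k = cast (fac N k)
    γ k = cast (fac n k)
    δ k = cast (fac m k)
    s k = cast (suc k)
    t k = cast (N ∸ k)
    A k = a k * b k

    v : Carrier → (ℕ → Carrier) → ℕ → Carrier
    v c f k = s k * f (suc k) - t k * (c * f k)

    minor-sum per-sum v-sum : Carrier
    minor-sum = ∑ℕ[ k < suc N ] (α k * A k)
    per-sum = ∑ℕ[ k < suc n ] (γ k * (adjoin p a k * adjoin q b k))
    v-sum = ∑ℕ[ k < N ] (δ k * (v p a k * v q b k))

    diagonal cross v-diagonal v-cross : ℕ → Carrier
    diagonal k = A (suc k) + p * q * A k
    cross k = p * (a k * b (suc k)) + q * (a (suc k) * b k)
    v-diagonal k = δ k * (s k * s k * A (suc k) + t k * t k * (p * q * A k))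
    v-cross k = δ k * (s k * t k * cross k)

    per-diagonal per-cross : Carrier
    per-diagonal = γ 0 * A 0 + ∑ℕ[ k < suc N ] (γ (suc k) * diagonal k)
    per-cross = ∑ℕ[ k < suc N ] (γ (suc k) * cross k)

    n≈s+t : ∀ k → k ≤ N → cast n ≈ s k + t k
    n≈s+t k k≤N = trans (cast-cong (≡.sym (m+[n∸m]≡n (s≤s k≤N)))) (×-homo-+ 1# (suc k) (N ∸ k))

    v-entry : ∀ c f k → k < N → cast n * f (suc k) - t k * adjoin c f (suc k) ≈ v c f k
    v-entry c f k k<N = begin
      cast n * f (suc k) - t k * (c * f k + f (suc k))
        ≈⟨ +-cong (*-congʳ (n≈s+t k (<⇒≤ k<N))) (-‿cong (distribˡ (t k) _ _)) ⟩
      (s k + t k) * f (suc k) - (t k * (c * f k) + t k * f (suc k))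
        ≈⟨ +-congʳ (distribʳ (f (suc k)) (s k) (t k)) ⟩
      (s k * f (suc k) + t k * f (suc k)) - (t k * (c * f k) + t k * f (suc k))
        ≈⟨ +-sub-+ _ _ _ ⟩
      s k * f (suc k) - t k * (c * f k) ∎

    δt≈αt : ∀ k → k ≤ N → δ k * t k * t k ≈ α k * t k
    δt≈αt k k≤N with m≤n⇒m<n∨m≡n k≤N
    ... | inj₁ k<N    = *-congʳ (cast-fac-∸ (≤-pred k<N))
    ... | inj₂ ≡.refl = begin
      δ N * t N * t N  ≈⟨ *-congˡ tN≈0 ⟩
      δ N * t N * 0#   ≈⟨ zeroʳ _ ⟩
      0#               ≈⟨ zeroʳ _ ⟨
      α N * 0#         ≈⟨ *-congˡ tN≈0 ⟨
      α N * t N        ∎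
      where tN≈0 = cast-cong (n∸n≡0 N)

    coefficient-shifted : ∀ k → k < N → γ (suc k) + δ k * s k * s k ≈ cast n * α (suc k)
    coefficient-shifted k k<N = begin
      γ (suc k) + δ k * s k * s k        ≈⟨ +-cong (sym (cast-fac-∸ k<N)) (*-congʳ (cast-fac-suc m k)) ⟩
      α (suc k) * t k + α (suc k) * s k  ≈⟨ solve 3 (λ a t s → a :* t :+ a :* s := (s :+ t) :* a)
                                                   refl (α (suc k)) (t k) (s k) ⟩
      (s k + t k) * α (suc k)            ≈⟨ *-congʳ (n≈s+t k (<⇒≤ k<N)) ⟨
      cast n * α (suc k)                 ∎

    coefficient-aligned : ∀ k → k ≤ N → γ (suc k) + δ k * t k * t k ≈ cast n * α k
    coefficient-aligned k k≤N = begin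
      γ (suc k) + δ k * t k * t k  ≈⟨ +-cong (sym (cast-fac-suc N k)) (δt≈αt k k≤N) ⟩
      α k * s k + α k * t k        ≈⟨ solve 3 (λ a s t → a :* s :+ a :* t := (s :+ t) :* a) refl (α k) (s k) (t k) ⟩
      (s k + t k) * α k            ≈⟨ *-congʳ (n≈s+t k k≤N) ⟨
      cast n * α k                 ∎

    per-split : per-sum ≈ per-diagonal + per-cross
    per-split = begin
      γ 0 * A 0 + ∑ℕ[ k < suc N ] (γ (suc k) * ((p * a k + a (suc k)) * (q * b k + b (suc k))))
        ≈⟨ +-congˡ (sumℕ-cong (suc N) λ k _ → expand k) ⟩
      γ 0 * A 0 + ∑ℕ[ k < suc N ] (γ (suc k) * diagonal k + γ (suc k) * cross k)
        ≈⟨ +-congˡ (∑ℕ-distrib-+ (suc N) (λ k → γ (suc k) * diagonal k) (λ k → γ (suc k) * cross k)) ⟩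
      γ 0 * A 0 + (∑ℕ[ k < suc N ] (γ (suc k) * diagonal k) + per-cross)
        ≈⟨ +-assoc _ _ _ ⟨
      per-diagonal + per-cross ∎
      where
      expand : ∀ k → γ (suc k) * ((p * a k + a (suc k)) * (q * b k + b (suc k)))
                     ≈ γ (suc k) * diagonal k + γ (suc k) * cross k
      expand k = solve 7 (λ g p q a a′ b b′ → g :* ((p :* a :+ a′) :* (q :* b :+ b′))
                                              := g :* (a′ :* b′ :+ p :* q :* (a :* b)) :+ g :* (p :* (a :* b′) :+ q :* (a′ :* b)))
                         refl (γ (suc k)) p q (a k) (a (suc k)) (b k) (b (suc k))

    v-product : ∀ k → δ k * (v p a k * v q b k) ≈ v-diagonal k - v-cross k
    v-product k = begin
      δ k * (v p a k * v q b k)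
        ≈⟨ *-congˡ (sub-*-sub (s k * a (suc k)) (t k * (p * a k)) (s k * b (suc k)) (t k * (q * b k))) ⟩
      δ k * ((s k * a (suc k) * (s k * b (suc k)) + t k * (p * a k) * (t k * (q * b k)))
             - (s k * a (suc k) * (t k * (q * b k)) + t k * (p * a k) * (s k * b (suc k))))
        ≈⟨ x[y-z]≈xy-xz (δ k) _ _ ⟩
      δ k * (s k * a (suc k) * (s k * b (suc k)) + t k * (p * a k) * (t k * (q * b k)))
        - δ k * (s k * a (suc k) * (t k * (q * b k)) + t k * (p * a k) * (s k * b (suc k)))
        ≈⟨ +-cong (*-congˡ (solve 8 (λ s t p q a a′ b b′ → s :* a′ :* (s :* b′) :+ t :* (p :* a) :* (t :* (q :* b))
                                                          := s :* s :* (a′ :* b′) :+ t :* t :* (p :* q :* (a :* b)))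
                                     refl (s k) (t k) p q (a k) (a (suc k)) (b k) (b (suc k))))
                  (-‿cong (*-congˡ (solve 8 (λ s t p q a a′ b b′ → s :* a′ :* (t :* (q :* b)) :+ t :* (p :* a) :* (s :* b′)
                                                                  := s :* t :* (p :* (a :* b′) :+ q :* (a′ :* b)))
                                               refl (s k) (t k) p q (a k) (a (suc k)) (b k) (b (suc k))))) ⟩
      v-diagonal k - v-cross k ∎

    cross-match : ∑ℕ[ k < N ] v-cross k ≈ per-cross
    cross-match = begin
      ∑ℕ[ k < N ] v-cross k
        ≈⟨ sumℕ-cong N (λ k k<N → trans (solve 4 (λ d s t c → d :* (s :* t :* c) := d :* s :* t :* c)
                                                  refl (δ k) (s k) (t k) (cross k))
                                         (*-congʳ (trans (*-congʳ (cast-fac-suc m k)) (cast-fac-∸ k<N)))) ⟩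
      ∑ℕ[ k < N ] (γ (suc k) * cross k)
        ≈⟨ +-identityʳ _ ⟨
      ∑ℕ[ k < N ] (γ (suc k) * cross k) + 0#
        ≈⟨ +-congˡ last≈0 ⟨
      ∑ℕ[ k < N ] (γ (suc k) * cross k) + γ (suc N) * cross N
        ≈⟨ sumℕ-last N (λ k → γ (suc k) * cross k) ⟨
      per-cross ∎
      where
      last≈0 : γ (suc N) * cross N ≈ 0#
      last≈0 = begin
        γ (suc N) * (p * (a N * b (suc N)) + q * (a (suc N) * b N))
          ≈⟨ *-congˡ (+-cong (*-congˡ (*-congˡ b-vanish)) (*-congˡ (*-congʳ a-vanish))) ⟩
        γ (suc N) * (p * (a N * 0#) + q * (0# * b N))
          ≈⟨ solve 5 (λ g p q a b → g :* (p :* (a :* con 0) :+ q :* (con 0 :* b)) := con 0) refl (γ (suc N)) p q (a N) (b N) ⟩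
        0# ∎

    diagonal-sum : ∑ℕ[ k < suc N ] (γ (suc k) * diagonal k)
                   ≈ ∑ℕ[ k < N ] (γ (suc k) * A (suc k)) + ∑ℕ[ k < suc N ] (γ (suc k) * (p * q * A k))
    diagonal-sum = begin
      ∑ℕ[ k < suc N ] (γ (suc k) * diagonal k)
        ≈⟨ sumℕ-cong (suc N) (λ k _ → distribˡ (γ (suc k)) (A (suc k)) (p * q * A k)) ⟩
      ∑ℕ[ k < suc N ] (γ (suc k) * A (suc k) + γ (suc k) * (p * q * A k))
        ≈⟨ ∑ℕ-distrib-+ (suc N) (λ k → γ (suc k) * A (suc k)) (λ k → γ (suc k) * (p * q * A k)) ⟩
      ∑ℕ[ k < suc N ] (γ (suc k) * A (suc k)) + G₂
        ≈⟨ +-congʳ (sumℕ-last N (λ k → γ (suc k) * A (suc k))) ⟩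
      (∑ℕ[ k < N ] (γ (suc k) * A (suc k)) + γ (suc N) * (a (suc N) * b (suc N))) + G₂
        ≈⟨ +-congʳ (+-congˡ (*-congˡ (*-congʳ a-vanish))) ⟩
      (∑ℕ[ k < N ] (γ (suc k) * A (suc k)) + γ (suc N) * (0# * b (suc N))) + G₂
        ≈⟨ solve 4 (λ G g b H → (G :+ g :* (con 0 :* b)) :+ H := G :+ H)
                   refl (∑ℕ[ k < N ] (γ (suc k) * A (suc k))) (γ (suc N)) (b (suc N)) G₂ ⟩
      ∑ℕ[ k < N ] (γ (suc k) * A (suc k)) + G₂ ∎
      where G₂ = ∑ℕ[ k < suc N ] (γ (suc k) * (p * q * A k))

    v-diagonal-sum : ∑ℕ[ k < N ] v-diagonal k
                     ≈ ∑ℕ[ k < N ] (δ k * s k * s k * A (suc k)) + ∑ℕ[ k < suc N ] (δ k * t k * t k * (p * q * A k))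
    v-diagonal-sum = begin
      ∑ℕ[ k < N ] v-diagonal k
        ≈⟨ sumℕ-cong N (λ k _ → solve 6 (λ d s t A′ P A → d :* (s :* s :* A′ :+ t :* t :* (P :* A))
                                                          := d :* s :* s :* A′ :+ d :* t :* t :* (P :* A))
                                         refl (δ k) (s k) (t k) (A (suc k)) (p * q) (A k)) ⟩
      ∑ℕ[ k < N ] (δ k * s k * s k * A (suc k) + δ k * t k * t k * (p * q * A k))
        ≈⟨ ∑ℕ-distrib-+ N (λ k → δ k * s k * s k * A (suc k)) D₂ ⟩
      ∑ℕ[ k < N ] (δ k * s k * s k * A (suc k)) + ∑ℕ[ k < N ] D₂ k
        ≈⟨ +-congˡ (trans (sym (+-identityʳ _)) (+-congˡ (sym last≈0))) ⟩
      ∑ℕ[ k < N ] (δ k * s k * s k * A (suc k)) + (∑ℕ[ k < N ] D₂ k + D₂ N)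
        ≈⟨ +-congˡ (sumℕ-last N D₂) ⟨
      ∑ℕ[ k < N ] (δ k * s k * s k * A (suc k)) + ∑ℕ[ k < suc N ] D₂ k ∎
      where
      D₂ : ℕ → Carrier
      D₂ k = δ k * t k * t k * (p * q * A k)

      last≈0 : D₂ N ≈ 0#
      last≈0 = begin
        δ N * t N * t N * (p * q * A N)  ≈⟨ *-congʳ (*-congˡ (cast-cong (n∸n≡0 N))) ⟩
        δ N * t N * 0# * (p * q * A N)   ≈⟨ solve 3 (λ d t x → d :* t :* con 0 :* x := con 0) refl (δ N) (t N) (p * q * A N) ⟩
        0#                               ∎

    diagonal-match : per-diagonal + ∑ℕ[ k < N ] v-diagonal k ≈ cast n * ((1# + p * q) * minor-sum)
    diagonal-match = begin
      (γ 0 * A 0 + ∑ℕ[ k < suc N ] (γ (suc k) * diagonal k)) + ∑ℕ[ k < N ] v-diagonal k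
        ≈⟨ +-cong (+-congˡ diagonal-sum) v-diagonal-sum ⟩
      (γ 0 * A 0 + (G₁ + G₂)) + (D₁ + D₂)
        ≈⟨ solve 5 (λ c g₁ g₂ d₁ d₂ → (c :+ (g₁ :+ g₂)) :+ (d₁ :+ d₂) := (c :+ (g₁ :+ d₁)) :+ (g₂ :+ d₂))
                   refl (γ 0 * A 0) G₁ G₂ D₁ D₂ ⟩
      (γ 0 * A 0 + (G₁ + D₁)) + (G₂ + D₂)
        ≈⟨ +-cong (+-cong (*-congʳ γ₀) shifted) aligned ⟩
      ∑ℕ[ k < suc N ] (cast n * α k * A k) + ∑ℕ[ k < suc N ] (cast n * α k * (p * q * A k))
        ≈⟨ ∑ℕ-distrib-+ (suc N) (λ k → cast n * α k * A k) (λ k → cast n * α k * (p * q * A k)) ⟨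
      ∑ℕ[ k < suc N ] (cast n * α k * A k + cast n * α k * (p * q * A k))
        ≈⟨ sumℕ-cong (suc N) (λ k _ → solve 4 (λ c a A P → c :* a :* A :+ c :* a :* (P :* A) := c :* ((con 1 :+ P) :* (a :* A)))
                                               refl (cast n) (α k) (A k) (p * q)) ⟩
      ∑ℕ[ k < suc N ] (cast n * ((1# + p * q) * (α k * A k)))
        ≈⟨ *-distribˡ-∑ℕ (suc N) (cast n) (λ k → (1# + p * q) * (α k * A k)) ⟨
      cast n * ∑ℕ[ k < suc N ] ((1# + p * q) * (α k * A k))
        ≈⟨ *-congˡ (*-distribˡ-∑ℕ (suc N) (1# + p * q) (λ k → α k * A k)) ⟨
      cast n * ((1# + p * q) * minor-sum) ∎
      where
      G₁ G₂ D₁ D₂ : Carrier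
      G₁ = ∑ℕ[ k < N ] (γ (suc k) * A (suc k))
      G₂ = ∑ℕ[ k < suc N ] (γ (suc k) * (p * q * A k))
      D₁ = ∑ℕ[ k < N ] (δ k * s k * s k * A (suc k))
      D₂ = ∑ℕ[ k < suc N ] (δ k * t k * t k * (p * q * A k))

      γ₀ : γ 0 ≈ cast n * α 0
      γ₀ = trans (cast-cong (fac-zero N)) (×1-homo-* n (fac N 0))

      shifted : G₁ + D₁ ≈ ∑ℕ[ k < N ] (cast n * α (suc k) * A (suc k))
      shifted = trans (sym (∑ℕ-distrib-+ N (λ k → γ (suc k) * A (suc k)) (λ k → δ k * s k * s k * A (suc k))))
                      (sumℕ-cong N λ k k<N → trans (sym (distribʳ (A (suc k)) (γ (suc k)) (δ k * s k * s k)))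
                                                    (*-congʳ (coefficient-shifted k k<N)))

      aligned : G₂ + D₂ ≈ ∑ℕ[ k < suc N ] (cast n * α k * (p * q * A k))
      aligned = trans (sym (∑ℕ-distrib-+ (suc N) (λ k → γ (suc k) * (p * q * A k)) (λ k → δ k * t k * t k * (p * q * A k))))
                      (sumℕ-cong (suc N) λ k k≤N → trans (sym (distribʳ (p * q * A k) (γ (suc k)) (δ k * t k * t k)))
                                                         (*-congʳ (coefficient-aligned k (≤-pred k≤N))))

    core : cast n * ((1# + p * q) * minor-sum) ≈ per-sum + v-sum
    core = begin
      cast n * ((1# + p * q) * minor-sum)
        ≈⟨ diagonal-match ⟨
      per-diagonal + ∑ℕ[ k < N ] v-diagonal k
        ≈⟨ +-+-sub per-diagonal (∑ℕ[ k < N ] v-diagonal k) (∑ℕ[ k < N ] v-cross k) ⟨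
      (per-diagonal + ∑ℕ[ k < N ] v-cross k) + (∑ℕ[ k < N ] v-diagonal k - ∑ℕ[ k < N ] v-cross k)
        ≈⟨ +-cong (+-congˡ cross-match) (sym (∑ℕ-sub N v-diagonal v-cross)) ⟩
      (per-diagonal + per-cross) + ∑ℕ[ k < N ] (v-diagonal k - v-cross k)
        ≈⟨ +-cong per-split (sumℕ-cong N λ k _ → v-product k) ⟨
      per-sum + v-sum ∎

  -- Conjugation and the entries of H, 𝒞₁(H) and v_k

  module Conjugation (conj : Carrier → Carrier) (isConj : IsConjugation R conj) where
    open IsConjugation isConj

    conj-0# : conj 0# ≈ 0#
    conj-0# = x+x≈x⇒x≈0 (conj 0#) (trans (sym (conj-+ 0# 0#)) (conj-cong (+-identityʳ 0#)))

    conj-sub : ∀ y z → conj (y - z) ≈ conj y - conj z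
    conj-sub y z = trans (conj-+ y (- z)) (+-congˡ (+-inverseˡ-unique (conj (- z)) (conj z)
                   (trans (sym (conj-+ (- z) z)) (trans (conj-cong (-‿inverseˡ z)) conj-0#))))

    conj-· : ∀ k y → conj (_·_ R k y) ≈ _·_ R k (conj y)
    conj-· zero    y = conj-0#
    conj-· (suc k) y = trans (conj-+ y (_·_ R k y)) (+-congˡ (conj-· k y))

    conj-e : ∀ {n} k (y : Vector Carrier n) → conj (e k y) ≈ e k (conj ∘ y)
    conj-e         zero    y = conj-1
    conj-e {zero}  (suc k) y = conj-0#
    conj-e {suc n} (suc k) y = trans (conj-+ _ _)
      (+-cong (trans (conj-* _ _) (*-congˡ (conj-e k (y ∘ suc)))) (conj-e (suc k) (y ∘ suc)))

  module Entries (conj : Carrier → Carrier) (isConj : IsConjugation R conj)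
                 (m : ℕ) (x : Vector Carrier (suc (suc m))) (i j : Fin (suc (suc m))) where
    open WithConj R conj
    open Conjugation conj isConj
    open IsConjugation isConj using (conj-1)

    x̄ : Vector Carrier (suc (suc m))
    x̄ = conj ∘ x

    a b : ℕ → Carrier
    a k = e k (x ∘ punchIn i)
    b k = e k (x̄ ∘ punchIn j)

    open CofactorIdentity m (x i) (x̄ j) a b
           (e-vanish (suc (suc m)) (x ∘ punchIn i) ≤-refl) (e-vanish (suc (suc m)) (x̄ ∘ punchIn j) ≤-refl) public

    outer-ones : outer ones i j ≈ 1#
    outer-ones = trans (*-congˡ conj-1) (*-identityˡ 1#)

    H≈onePlusOuter : ∀ r s → Hmat x r s ≈ onePlusOuter x x̄ r s
    H≈onePlusOuter r s = +-congʳ outer-ones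

    C₁-entry : C₁ R (Hmat x) i j ≈ (1# + x i * x̄ j) * minor-sum
    C₁-entry = *-cong (H≈onePlusOuter i j) (trans (per-cong λ r s → H≈onePlusOuter (punchIn i r) (punchIn j s))
                                                  (per-onePlusOuter N (x ∘ punchIn i) (x̄ ∘ punchIn j)))

    per-H : per R (Hmat x) ≈ per-sum
    per-H = trans (per-cong H≈onePlusOuter) (trans (per-onePlusOuter n x x̄)
      (sumℕ-cong (suc n) λ k _ → *-congˡ {γ k} (*-cong (e-adjoin k x i) (e-adjoin k x̄ j))))

    vk-entry : ∀ (y : Vector Carrier n) l k → k < N → vk R (suc k) y l ≈ v (y l) (λ k → e k (y ∘ punchIn l)) k
    vk-entry y l k k<N = begin
      vk R (suc k) y l
        ≈⟨ +-cong (·≈cast* n _) (-‿cong (·≈cast* (N ∸ k) _)) ⟩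
      cast n * esym R (suc k) (y ∘ punchIn l) - t k * esym R (suc k) y
        ≡⟨ ≡.cong₂ (λ u w → cast n * u - t k * w) (esym≡e (suc k) (y ∘ punchIn l)) (esym≡e (suc k) y) ⟩
      cast n * e (suc k) (y ∘ punchIn l) - t k * e (suc k) y
        ≈⟨ +-congˡ (-‿cong (*-congˡ (e-adjoin (suc k) y l))) ⟩
      cast n * e (suc k) (y ∘ punchIn l) - t k * adjoin (y l) (λ k → e k (y ∘ punchIn l)) (suc k)
        ≈⟨ v-entry (y l) (λ k → e k (y ∘ punchIn l)) k k<N ⟩
      v (y l) (λ k → e k (y ∘ punchIn l)) k ∎

    conj-vk : ∀ k → conj (vk R k x j) ≈ vk R k x̄ j
    conj-vk k = trans (conj-sub _ _) (+-cong (trans (conj-· n _) (·-congˡ n (conj-esym (x ∘ punchIn j))))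
                                          (-‿cong (trans (conj-· (n ∸ k) _) (·-congˡ (n ∸ k) (conj-esym x)))))
      where
      conj-esym : ∀ {n} (y : Vector Carrier n) → conj (esym R k y) ≈ esym R k (conj ∘ y)
      conj-esym y = trans (reflexive (≡.cong conj (esym≡e k y)))
                          (trans (conj-e k y) (reflexive (≡.sym (esym≡e k (conj ∘ y)))))

    rhs : ∀ c → (per R (Hmat x) * c) * outer ones i j
                + Σ[_] R (λ (k′ : Fin N) → (_·_ R (fac m (toℕ k′)) 1# * c) * outer (vk R (suc (toℕ k′)) x) i j)
                ≈ c * (per-sum + v-sum)
    rhs c = begin
      (per R (Hmat x) * c) * outer ones i j
        + Σ[_] R (λ (k′ : Fin N) → (_·_ R (fac m (toℕ k′)) 1# * c) * outer (vk R (suc (toℕ k′)) x) i j)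
        ≡⟨ ≡.cong ((per R (Hmat x) * c) * outer ones i j +_) (Σ≡sum {N} _) ⟩
      (per R (Hmat x) * c) * outer ones i j
        + ∑ℕ[ k < N ] ((_·_ R (fac m k) 1# * c) * (vk R (suc k) x i * conj (vk R (suc k) x j)))
        ≈⟨ +-cong (*-cong (*-congʳ per-H) outer-ones) (sumℕ-cong N λ k k<N → *-cong
             (*-congʳ {c} (trans (·≈cast* (fac m k) 1#) (*-identityʳ (δ k))))
             (*-cong (vk-entry x i k k<N) (trans (conj-vk (suc k)) (vk-entry x̄ j k k<N)))) ⟩
      (per-sum * c) * 1# + ∑ℕ[ k < N ] ((δ k * c) * (v (x i) a k * v (x̄ j) b k))
        ≈⟨ +-cong (solve 2 (λ P c → (P :* c) :* con 1 := c :* P) refl per-sum c)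
                  (sumℕ-cong N λ k _ → solve 3 (λ d c w → (d :* c) :* w := c :* (d :* w)) refl (δ k) c (v (x i) a k * v (x̄ j) b k)) ⟩
      c * per-sum + ∑ℕ[ k < N ] (c * (δ k * (v (x i) a k * v (x̄ j) b k)))
        ≈⟨ +-congˡ (*-distribˡ-∑ℕ N c (λ k → δ k * (v (x i) a k * v (x̄ j) b k))) ⟨
      c * per-sum + c * v-sum
        ≈⟨ distribˡ c per-sum v-sum ⟨
      c * (per-sum + v-sum) ∎

proposition3p2 : ∀ {c ℓ} (R : CommutativeRing c ℓ)
    (conj : CommutativeRing.Carrier R → CommutativeRing.Carrier R) → IsConjugation R conj →
    (m : ℕ) (x : Vector (CommutativeRing.Carrier R) (suc (suc m)))
    (n⁻¹ : CommutativeRing.Carrier R) →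
    let open CommutativeRing R
        open WithConj R conj
        n = suc (suc m)
        H = Hmat x
    in (_·_ R n 1#) * n⁻¹ ≈ 1# →
       ∀ i j → C₁ R H i j
         ≈ (per R H * n⁻¹) * outer ones i j
           + Σ[_] R (λ (k′ : Fin (suc m)) →
               (_·_ R (toℕ k′ ! Data.Nat.* (m ∸ toℕ k′) !) 1# * n⁻¹)
               * outer (vk R (suc (toℕ k′)) x) i j)
proposition3p2 R conj isConj m x n⁻¹ n·1*n⁻¹≈1 i j = begin
  C₁ R (Hmat x) i j                                  ≈⟨ C₁-entry ⟩
  (1# + x i * x̄ j) * minor-sum                        ≈⟨ inverse-cancel (cast n) n⁻¹ _ n*n⁻¹≈1 ⟩
  n⁻¹ * (cast n * ((1# + x i * x̄ j) * minor-sum))     ≈⟨ *-congˡ core ⟩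
  n⁻¹ * (per-sum + v-sum)                             ≈⟨ rhs n⁻¹ ⟨
  (per R (Hmat x) * n⁻¹) * outer ones i j
    + Σ[_] R (λ (k′ : Fin (suc m)) → (_·_ R (fac m (toℕ k′)) 1# * n⁻¹) * outer (vk R (suc (toℕ k′)) x) i j) ∎
  where
  open CommutativeRing R
  open WithConj R conj
  open Lemmas R
  open Entries conj isConj m x i j
  open SetoidReasoning setoid

  n*n⁻¹≈1 : cast n * n⁻¹ ≈ 1#
  n*n⁻¹≈1 = trans (*-congʳ (trans (sym (*-identityʳ _)) (sym (·≈cast* n 1#)))) n·1*n⁻¹≈1
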